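{- Let $\Sigma,\Gamma$ be finite alphabets and $\pi:\Sigma_\square\times m\to\Gamma$ a well-defined strict interpretation. Then its de-strictification $\pi^\dagger:\Sigma\times m\to\Gamma$ is well-defined, and $[\![\pi^\dagger]\!]=d\circ[\![\pi]\!]$.
   Context: Strings as structures: a string $s\in\Sigma^\star$ is identified with the structure with domain $\{0,\dots,|s|-1\}$, unary predicates $\sigma$ ($\sigma\in\Sigma$) true at indices carrying $\sigma$, $\min$ (true only at $0$), $\max$ (true only at $|s|-1$), and functions $\mathrm{S}$ ($x\mapsto x+1$, fixing $|s|-1$), $\mathrm{P}$ ($x\mapsto x-1$, fixing $0$). BMRS: terms over a single variable $\mathtt{x}$: index terms $\mathtt{x},\mathrm{S}(T),\mathrm{P}(T)$ and index if-then-else; boolean terms $\mathtt{tt},\mathtt{ff},\mathtt{f}(T),\sigma(T),\max(T),\min(T)$ and boolean if-then-else. A headless BMRS is a finite set of recursive definitions $\mathtt{f}_i(\mathtt{x})=T_i$ with boolean bodies; evaluation $s,x\vdash T\to v$ is the standard least big-step relation. A BMRS is a headless BMRS plus finitely many terms called heads. Interpretations: $\pi:\Sigma\times m\to\Gamma$ is a $\Gamma$-BMRS with heads $\pi(\sigma,i)$ ($\sigma\in\Sigma,i<m$). Well-defined: for all $s\in\Gamma^\star$, $i<m$, $x<|s|$, $s,x\vdash\pi(\sigma,i)\to\top$ for at most one $\sigma$ and $\to\bot$ for all others; strict: exactly one. For well-defined $\pi$ and $s\in\Gamma^\star$, let $J$ be the set of $(q,r)\in|s|\times m$ with $s,q\vdash\pi(\sigma,r)\to\top$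 for some $\sigma$, ordered lexicographically ($q$ more significant); $[\![\pi]\!](s)$ has length $|J|$ and carries $\sigma$ at $x$ iff $s,q\vdash\pi(\sigma,r)\to\top$ for the element $(q,r)$ of $J$ with $x$ predecessors. Blanks: $\square$ is a fresh symbol, $\Sigma_\square=\Sigma\cup\{\square\}$, $d:\Sigma_\square^\star\to\Sigma^\star$ deletes all $\square$. De-strictification: $\pi^\dagger:\Sigma\times m\to\Gamma$ has the same body as $\pi$ and heads $\pi^\dagger(\sigma,i)=\pi(\sigma,i)$ for $\sigma\in\Sigma$, $i<m$ (the heads $\pi(\square,i)$ are discarded). -}

module Defs where

open import Data.Nat using (ℕ; zero; suc; _<_; _∸_; _<?_)
open import Data.Nat.Properties using (≤-refl; m<n⇒m<1+n)
open import Data.Fin using (Fin)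
import Data.Fin as Fin
open import Data.Bool using (Bool; true; false)
open import Data.List using (List; []; _∷_; length; _++_; concat)
open import Data.Maybe using (Maybe; just; nothing)
open import Data.Product using (Σ; Σ-syntax; _×_; _,_; proj₁)
open import Relation.Nullary using (¬_; yes; no)
open import Relation.Nullary.Decidable using (⌊_⌋)
import Data.Nat as ℕ
open import Relation.Binary.PropositionalEquality using (_≡_; _≢_)

at : ∀ {A : Set} → List A → ℕ → Maybe A
at []       _       = nothing
at (c ∷ s)  zero    = just c
at (c ∷ s)  (suc y) = at s y

succS : ∀ {A : Set} → List A → ℕ → ℕ
succS s y with suc y <? length s
... | yes _ = suc y
... | no  _ = y

predS : ℕ → ℕ
predS y = y ∸ 1

-- BMRS terms over a single variable x, with n recursive function symbols
-- and alphabet Γ = Fin g.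

mutual
  data ITerm (n g : ℕ) : Set where
    var  : ITerm n g
    S    : ITerm n g → ITerm n g
    P    : ITerm n g → ITerm n g
    ite  : BTerm n g → ITerm n g → ITerm n g → ITerm n g

  data BTerm (n g : ℕ) : Set where
    tt ff : BTerm n g
    call  : Fin n → ITerm n g → BTerm n g
    sym   : Fin g → ITerm n g → BTerm n g
    isMax : ITerm n g → BTerm n g
    isMin : ITerm n g → BTerm n g
    bite  : BTerm n g → BTerm n g → BTerm n g → BTerm n g

-- A headless BMRS: definitions f_i(x) = body i.
Headless : ℕ → ℕ → Set
Headless n g = Fin n → BTerm n g

symAt : ∀ {g} → List (Fin g) → ℕ → Fin g → Bool
symAt s y σ with at s y
... | just c  = ⌊ c Fin.≟ σ ⌋
... | nothing = false

-- Big-step evaluation  s , x ⊢ T → v  (least relation = inductive type).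
module Eval {n g : ℕ} (body : Headless n g) (s : List (Fin g)) where
  mutual
    data _⊢ᵢ_⇓_ : ℕ → ITerm n g → ℕ → Set where
      e-var  : ∀ {x} → x ⊢ᵢ var ⇓ x
      e-S    : ∀ {x T y} → x ⊢ᵢ T ⇓ y → x ⊢ᵢ S T ⇓ succS s y
      e-P    : ∀ {x T y} → x ⊢ᵢ T ⇓ y → x ⊢ᵢ P T ⇓ predS y
      e-iteT : ∀ {x B T₁ T₂ y} → x ⊢ᵇ B ⇓ true  → x ⊢ᵢ T₁ ⇓ y → x ⊢ᵢ ite B T₁ T₂ ⇓ y
      e-iteF : ∀ {x B T₁ T₂ y} → x ⊢ᵇ B ⇓ false → x ⊢ᵢ T₂ ⇓ y → x ⊢ᵢ ite B T₁ T₂ ⇓ y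

    data _⊢ᵇ_⇓_ : ℕ → BTerm n g → Bool → Set where
      e-tt    : ∀ {x} → x ⊢ᵇ tt ⇓ true
      e-ff    : ∀ {x} → x ⊢ᵇ ff ⇓ false
      e-call  : ∀ {x f T y v} → x ⊢ᵢ T ⇓ y → y ⊢ᵇ body f ⇓ v → x ⊢ᵇ call f T ⇓ v
      e-sym   : ∀ {x σ T y} → x ⊢ᵢ T ⇓ y → x ⊢ᵇ sym σ T ⇓ symAt s y σ
      e-max   : ∀ {x T y} → x ⊢ᵢ T ⇓ y → x ⊢ᵇ isMax T ⇓ ⌊ suc y ℕ.≟ length s ⌋
      e-min   : ∀ {x T y} → x ⊢ᵢ T ⇓ y → x ⊢ᵇ isMin T ⇓ ⌊ y ℕ.≟ 0 ⌋
      e-biteT : ∀ {x B T₁ T₂ v} → x ⊢ᵇ B ⇓ true  → x ⊢ᵇ T₁ ⇓ v → x ⊢ᵇ bite B T₁ T₂ ⇓ v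
      e-biteF : ∀ {x B T₁ T₂ v} → x ⊢ᵇ B ⇓ false → x ⊢ᵇ T₂ ⇓ v → x ⊢ᵇ bite B T₁ T₂ ⇓ v

-- Interpretations π : A × m → Γ  (Γ = Fin g): a Γ-BMRS with heads π(σ,i).

record Interp (A : Set) (m g : ℕ) : Set where
  field
    nfun : ℕ
    body : Headless nfun g
    head : A → Fin m → BTerm nfun g
open Interp public

_,_⊢head_,_⇓_ : ∀ {A m g} (π : Interp A m g) → List (Fin g) → ℕ → A × Fin m → Bool → Set
π , s ⊢head x , (σ , i) ⇓ v = Eval._⊢ᵇ_⇓_ (body π) s x (head π σ i) v

-- Well-defined: for every s, i < m, x < |s| there is at most one σ with
-- π(σ,i) → ⊤, and π(σ,i) → ⊥ for all others.  The witness `o` is that σ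
-- (just σ) or the absence of one (nothing).
WellDefined : ∀ {A m g} → Interp A m g → Set
WellDefined {A} {m} {g} π =
  (s : List (Fin g)) (i : Fin m) (x : ℕ) → x < length s →
  Σ[ o ∈ Maybe A ] ((σ : A) →
      (o ≡ just σ → π , s ⊢head x , (σ , i) ⇓ true) ×
      (o ≢ just σ → π , s ⊢head x , (σ , i) ⇓ false))

Strict : ∀ {A m g} → Interp A m g → Set
Strict {A} {m} {g} π =
  (s : List (Fin g)) (i : Fin m) (x : ℕ) → x < length s →
  Σ[ σ₀ ∈ A ] ((σ : A) →
      (σ ≡ σ₀ → π , s ⊢head x , (σ , i) ⇓ true) ×
      (σ ≢ σ₀ → π , s ⊢head x , (σ , i) ⇓ false))

tabLt : ∀ {B : Set} (n : ℕ) → ((q : ℕ) → q < n → B) → List B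
tabLt zero    f = []
tabLt (suc n) f = tabLt n (λ q q<n → f q (m<n⇒m<1+n q<n)) ++ (f n ≤-refl ∷ [])

allFin : (m : ℕ) → List (Fin m)
allFin zero    = []
allFin (suc m) = Fin.zero ∷ Data.List.map Fin.suc (allFin m)

maybeToList : ∀ {B : Set} → Maybe B → List B
maybeToList (just b) = b ∷ []
maybeToList nothing  = []

-- The output ⟦π⟧(s): positions (q,r) ∈ |s| × m in lexicographic order
-- (q more significant), keeping those where some σ is produced, labelled by σ.
⟦_⟧ : ∀ {A m g} (π : Interp A m g) → WellDefined π → List (Fin g) → List A
⟦_⟧ {A} {m} π wd s =
  concat (tabLt (length s) (λ q q<|s| →
    concat (Data.List.map (λ r → maybeToList (proj₁ (wd s r q q<|s|))) (allFin m))))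

data Blank (A : Set) : Set where
  □   : Blank A
  ⌜_⌝ : A → Blank A

d : ∀ {A : Set} → List (Blank A) → List A
d []          = []
d (□ ∷ u)     = d u
d (⌜ a ⌝ ∷ u) = a ∷ d u

_† : ∀ {A m g} → Interp (Blank A) m g → Interp A m g
π † = record { nfun = nfun π ; body = body π ; head = λ σ i → head π ⌜ σ ⌝ i }

{-# OPTIONS --safe #-}
module Submission where

open import Defs hiding (sym)
open import Data.Nat using (ℕ; zero; suc; _<_)
open import Data.Nat.Properties using (≤-refl; m<n⇒m<1+n)
open import Data.Fin using (Fin)
open import Data.List using (List; []; _∷_; _++_; concat; map; length)
open import Data.List.Properties using (map-cong; map-∘; map-++)
open import Data.Maybe using (Maybe; just; nothing)
open import Data.Product using (Σ; _,_; proj₁; proj₂)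
open import Data.Bool using (true; false)
open import Function using (_∘_)
open import Relation.Binary.PropositionalEquality
  using (_≡_; _≢_; refl; cong; cong₂; sym; trans; module ≡-Reasoning)

-- The set J of π† is that of π with the positions producing □ removed, and
-- the blank-deleting map d commutes with the concatenations that build ⟦_⟧
-- from these positions.

private
  variable
    A B C : Set

unblank : Maybe (Blank A) → Maybe A
unblank (just ⌜ a ⌝) = just a
unblank (just □)      = nothing
unblank nothing       = nothing

unblank≡just⇒≡just⌜⌝ : ∀ (o : Maybe (Blank A)) {a} → unblank o ≡ just a → o ≡ just ⌜ a ⌝
unblank≡just⇒≡just⌜⌝ (just ⌜ a ⌝) refl = refl

maybeToList-unblank : ∀ (o : Maybe (Blank A)) → maybeToList (unblank o) ≡ d (maybeToList o)
maybeToList-unblank (just ⌜ a ⌝) = refl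
maybeToList-unblank (just □)      = refl
maybeToList-unblank nothing       = refl

d-++ : ∀ (u v : List (Blank A)) → d (u ++ v) ≡ d u ++ d v
d-++ []          v = refl
d-++ (□ ∷ u)     v = d-++ u v
d-++ (⌜ a ⌝ ∷ u) v = cong (a ∷_) (d-++ u v)

d-concat : ∀ (us : List (List (Blank A))) → d (concat us) ≡ concat (map d us)
d-concat []       = refl
d-concat (u ∷ us) = trans (d-++ u (concat us)) (cong (d u ++_) (d-concat us))

d-concat-map-maybeToList : ∀ (h : C → Maybe (Blank A)) (xs : List C) →
  d (concat (map (maybeToList ∘ h) xs)) ≡ concat (map (maybeToList ∘ unblank ∘ h) xs)
d-concat-map-maybeToList h xs = begin
  d (concat (map (maybeToList ∘ h) xs))          ≡⟨ d-concat (map (maybeToList ∘ h) xs) ⟩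
  concat (map d (map (maybeToList ∘ h) xs))      ≡⟨ cong concat (sym (map-∘ xs)) ⟩
  concat (map (d ∘ maybeToList ∘ h) xs)          ≡⟨ cong concat (map-cong (sym ∘ maybeToList-unblank ∘ h) xs) ⟩
  concat (map (maybeToList ∘ unblank ∘ h) xs)    ∎
  where open ≡-Reasoning

map-tabLt : ∀ (h : B → C) (n : ℕ) (f : (q : ℕ) → q < n → B) →
  map h (tabLt n f) ≡ tabLt n (λ q q<n → h (f q q<n))
map-tabLt h zero    f = refl
map-tabLt h (suc n) f = begin
  map h (tabLt n _ ++ _)          ≡⟨ map-++ h (tabLt n _) _ ⟩
  map h (tabLt n _) ++ _          ≡⟨ cong (_++ _) (map-tabLt h n _) ⟩
  tabLt n _ ++ _                  ∎
  where open ≡-Reasoning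

tabLt-cong : ∀ (n : ℕ) {f f′ : (q : ℕ) → q < n → B} →
  (∀ q q<n → f q q<n ≡ f′ q q<n) → tabLt n f ≡ tabLt n f′
tabLt-cong zero    f≗f′ = refl
tabLt-cong (suc n) f≗f′ =
  cong₂ _++_ (tabLt-cong n (λ q q<n → f≗f′ q (m<n⇒m<1+n q<n))) (cong (_∷ []) (f≗f′ n ≤-refl))

module _ {a m g : ℕ} (π : Interp (Blank (Fin a)) m g) (wd : WellDefined π) where

  wellDefined-† : WellDefined (π †)
  wellDefined-† s i x x<|s| = unblank o , λ σ →
      (λ unblank-o≡σ → holds ⌜ σ ⌝ (unblank≡just⇒≡just⌜⌝ o unblank-o≡σ))
    , (λ unblank-o≢σ → fails ⌜ σ ⌝ (unblank-o≢σ ∘ cong unblank))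
    where
    o : Maybe (Blank (Fin a))
    o = proj₁ (wd s i x x<|s|)
    holds : ∀ τ → o ≡ just τ → π , s ⊢head x , (τ , i) ⇓ true
    holds = proj₁ ∘ proj₂ (wd s i x x<|s|)
    fails : ∀ τ → o ≢ just τ → π , s ⊢head x , (τ , i) ⇓ false
    fails = proj₂ ∘ proj₂ (wd s i x x<|s|)

  ⟦†⟧≡d∘⟦⟧ : ∀ (s : List (Fin g)) → ⟦ π † ⟧ wellDefined-† s ≡ d (⟦ π ⟧ wd s)
  ⟦†⟧≡d∘⟦⟧ s = sym (begin
    d (concat (tabLt (length s) row))                   ≡⟨ d-concat (tabLt (length s) row) ⟩
    concat (map d (tabLt (length s) row))               ≡⟨ cong concat (map-tabLt d (length s) row) ⟩
    concat (tabLt (length s) (λ q q<|s| → d (row q q<|s|)))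
      ≡⟨ cong concat (tabLt-cong (length s) (λ q q<|s| →
           d-concat-map-maybeToList (λ r → proj₁ (wd s r q q<|s|)) (allFin m))) ⟩
    ⟦ π † ⟧ wellDefined-† s                             ∎)
    where
    open ≡-Reasoning
    row : (q : ℕ) → q < length s → List (Blank (Fin a))
    row q q<|s| = concat (map (λ r → maybeToList (proj₁ (wd s r q q<|s|))) (allFin m))

lemma3 : (a g m : ℕ) (π : Interp (Blank (Fin a)) m g) →
    (wd : WellDefined π) → Strict π →
    Σ (WellDefined (π †)) (λ wd† →
    (s : List (Fin g)) → ⟦ π † ⟧ wd† s ≡ d (⟦ π ⟧ wd s))
lemma3 a g m π wd _ = wellDefined-† π wd , ⟦†⟧≡d∘⟦⟧ π wd
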